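{- Let $c_1,\ldots,c_k$ be integers with $c_i\ge 2$, and define polynomials $\mathcal R_i,\mathcal S_i\in\mathbb Z[q]$ by $(\mathcal R_0,\mathcal R_1)=(1,[c_1]_q)$, $(\mathcal S_0,\mathcal S_1)=(0,1)$ and, for $1\le i\le k-1$, $$\mathcal R_{i+1}=[c_{i+1}]_q\mathcal R_i-q^{c_i-1}\mathcal R_{i-1},\qquad \mathcal S_{i+1}=[c_{i+1}]_q\mathcal S_i-q^{c_i-1}\mathcal S_{i-1}.$$ Then for all $1\le i\le k$: (i) the leading term of $\mathcal R_i$ is $q^{c_1+\cdots+c_i-i}$ and its constant term is $1$; (ii) the leading term of $\mathcal S_i$ is $q^{c_2+\cdots+c_i-i+1}$ and its constant term is $1$; (iii) $\mathcal R_i$ and $\mathcal S_i$ have positive integer coefficients (every nonzero coefficient is a positive integer); (iv) $\mathcal R_i$ and $\mathcal S_i$ are coprime.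
   Context: $q$ is a formal variable and $[a]_q=1+q+\cdots+q^{a-1}$ for a positive integer $a$. -}

module Defs where

open import Data.Nat as ℕ using (ℕ; zero; suc; _∸_)
open import Data.Integer as ℤ using (ℤ; +_; 0ℤ; 1ℤ; -1ℤ)
open import Data.List using (List; []; _∷_; map; replicate; _++_)
open import Data.Sum using (_⊎_)
open import Data.Product using (_×_; Σ)
open import Relation.Binary.PropositionalEquality using (_≡_)

-- Polynomials in ℤ[q] as coefficient lists, lowest degree first.
-- Lists differing by trailing zeros represent the same polynomial;
-- equality of polynomials is _≈ₚ_ (equality of all coefficients).
Poly : Set
Poly = List ℤ

coeff : Poly → ℕ → ℤ
coeff []      _       = 0ℤ
coeff (a ∷ p) zero    = a
coeff (a ∷ p) (suc n) = coeff p n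

infix 4 _≈ₚ_
_≈ₚ_ : Poly → Poly → Set
p ≈ₚ r = ∀ n → coeff p n ≡ coeff r n

infixl 6 _+ₚ_ _-ₚ_
infixl 7 _*ₚ_

_+ₚ_ : Poly → Poly → Poly
[]      +ₚ r       = r
(a ∷ p) +ₚ []      = a ∷ p
(a ∷ p) +ₚ (b ∷ r) = (a ℤ.+ b) ∷ (p +ₚ r)

negₚ : Poly → Poly
negₚ = map (λ a → ℤ.- a)

_-ₚ_ : Poly → Poly → Poly
p -ₚ r = p +ₚ negₚ r

scaleₚ : ℤ → Poly → Poly
scaleₚ a = map (a ℤ.*_)

_*ₚ_ : Poly → Poly → Poly
[]      *ₚ r = []
(a ∷ p) *ₚ r = scaleₚ a r +ₚ (0ℤ ∷ (p *ₚ r))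

qpow : ℕ → Poly
qpow n = replicate n 0ℤ ++ (1ℤ ∷ [])

qint : ℕ → Poly
qint a = replicate a 1ℤ

-- The sequence c_1, c_2, ... is given as a function c : ℕ → ℕ
-- (c 0 is unused).  R c i and S c i are 𝓡_i and 𝓢_i.
-- RS c i = (𝓡_i , 𝓡_{i+1}) etc. computed jointly by the recurrence.
record Pair : Set where
  constructor _,_
  field fst snd : Poly
open Pair

step : (ℕ → ℕ) → ℕ → Pair → Pair
step c i (x , y) = y , (qint (c (suc i)) *ₚ y -ₚ qpow (c i ∸ 1) *ₚ x)

-- pairs (X_i, X_{i+1}) starting from (X_0, X_1)
iter : (ℕ → ℕ) → Pair → ℕ → Pair
iter c p zero    = p
iter c p (suc i) = step c (suc i) (iter c p i)

R : (ℕ → ℕ) → ℕ → Poly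
R c i = fst (iter c ((1ℤ ∷ []) , qint (c 1)) i)

S : (ℕ → ℕ) → ℕ → Poly
S c i = fst (iter c ([] , (1ℤ ∷ [])) i)

-- c_a + c_{a+1} + ... + c_b  (empty sum = 0 when b < a), here as
-- sumFrom c a n = c_a + ... + c_{a+n-1}
sumFrom : (ℕ → ℕ) → ℕ → ℕ → ℕ
sumFrom c a zero    = 0
sumFrom c a (suc n) = c a ℕ.+ sumFrom c (suc a) n

LeadingTerm : Poly → ℕ → Set
LeadingTerm p d = coeff p d ≡ 1ℤ × (∀ n → d ℕ.< n → coeff p n ≡ 0ℤ)

ConstantTerm : Poly → ℤ → Set
ConstantTerm p a = coeff p 0 ≡ a

PositiveCoeffs : Poly → Set
PositiveCoeffs p = ∀ n → coeff p n ≡ 0ℤ ⊎ ℤ.0ℤ ℤ.< coeff p n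

_∣ₚ_ : Poly → Poly → Set
d ∣ₚ p = Σ Poly (λ a → p ≈ₚ d *ₚ a)

-- units of ℤ[q] are ±1
IsUnit : Poly → Set
IsUnit d = d ≈ₚ (1ℤ ∷ []) ⊎ d ≈ₚ (-1ℤ ∷ [])

Coprime : Poly → Poly → Set
Coprime p r = ∀ d → d ∣ₚ p → d ∣ₚ r → IsUnit d

module Submission where

-- Write X for 𝓡 or 𝓢 and G_i = X_i − q^(c_i − 1) X_{i−1}. Since [c]_q = 1 + q [c − 2]_q + q^(c − 1),
--   G_{i+1} = G_i + q [c_{i+1} − 2]_q X_i   and   X_{i+1} = G_{i+1} + q^(c_{i+1} − 1) X_i,
-- so by induction X_i and G_i have nonnegative coefficients and constant term 1, deg G_i ≤ deg X_i,
-- and the leading term of X_{i+1} is q^(deg X_i + c_{i+1} − 1).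
-- The determinant 𝓡_i 𝓢_{i+1} − 𝓡_{i+1} 𝓢_i gets multiplied by q^(c_i − 1) at each step, so it is a
-- power of q; a common divisor of 𝓡_i and 𝓢_i divides it and has constant term ±1, so it is ±1.

module PolyRing where

  open import Defs
  open import Data.Nat using (zero; suc)
  open import Data.Integer using (0ℤ; 1ℤ; _+_; _*_; -_; +-*-rawRing)
  import Data.Integer.Properties as ℤ
  open import Data.List using ([]; _∷_)
  open import Data.Maybe using (Maybe; just; nothing)
  open import Data.Product using (_,_)
  open import Level using (0ℓ)
  open import Relation.Binary.Bundles using (Setoid)
  open import Relation.Binary.PropositionalEquality
  open import Relation.Nullary using (yes; no)
  open import Algebra.Bundles using (CommutativeRing)
  import Algebra.Solver.Ring.AlmostCommutativeRing as ACR
  import Algebra.Solver.Ring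
  import Relation.Binary.Reasoning.Setoid as SetoidReasoning

  coeff-+ₚ : ∀ p r n → coeff (p +ₚ r) n ≡ coeff p n + coeff r n
  coeff-+ₚ []      r       n       = sym (ℤ.+-identityˡ _)
  coeff-+ₚ (a ∷ p) []      zero    = sym (ℤ.+-identityʳ a)
  coeff-+ₚ (a ∷ p) []      (suc n) = sym (ℤ.+-identityʳ _)
  coeff-+ₚ (a ∷ p) (b ∷ r) zero    = refl
  coeff-+ₚ (a ∷ p) (b ∷ r) (suc n) = coeff-+ₚ p r n

  coeff-negₚ : ∀ p n → coeff (negₚ p) n ≡ - coeff p n
  coeff-negₚ []      n       = refl
  coeff-negₚ (a ∷ p) zero    = refl
  coeff-negₚ (a ∷ p) (suc n) = coeff-negₚ p n

  coeff-scaleₚ : ∀ a p n → coeff (scaleₚ a p) n ≡ a * coeff p n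
  coeff-scaleₚ a []      n       = sym (ℤ.*-zeroʳ a)
  coeff-scaleₚ a (b ∷ p) zero    = refl
  coeff-scaleₚ a (b ∷ p) (suc n) = coeff-scaleₚ a p n

  coeff-∷-*ₚ : ∀ a p r n → coeff ((a ∷ p) *ₚ r) n ≡ a * coeff r n + coeff (0ℤ ∷ p *ₚ r) n
  coeff-∷-*ₚ a p r n = trans (coeff-+ₚ (scaleₚ a r) _ n) (cong (_+ _) (coeff-scaleₚ a r n))

  -- A record rather than _≈ₚ_ itself, so that both polynomials can be inferred from a proof.
  infix 4 _≋_
  record _≋_ (p r : Poly) : Set where
    constructor pointwise
    field at : p ≈ₚ r
  open _≋_ public

  ≋-setoid : Setoid 0ℓ 0ℓ
  ≋-setoid = record
    { Carrier       = Poly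
    ; _≈_           = _≋_
    ; isEquivalence = record
      { refl  = pointwise λ _ → refl
      ; sym   = λ e → pointwise λ n → sym (at e n)
      ; trans = λ e f → pointwise λ n → trans (at e n) (at f n)
      }
    }

  open Setoid ≋-setoid public using () renaming (refl to ≋-refl; sym to ≋-sym; trans to ≋-trans)
  module ≋-Reasoning = SetoidReasoning ≋-setoid

  ∷-cong : ∀ {a b p r} → a ≡ b → p ≋ r → (a ∷ p) ≋ (b ∷ r)
  ∷-cong a≡b p≋r = pointwise λ { zero → a≡b ; (suc n) → at p≋r n }

  +ₚ-cong : ∀ {p p′ r r′} → p ≋ p′ → r ≋ r′ → p +ₚ r ≋ p′ +ₚ r′
  +ₚ-cong {p} {p′} {r} {r′} e f = pointwise λ n →
    trans (coeff-+ₚ p r n) (trans (cong₂ _+_ (at e n) (at f n)) (sym (coeff-+ₚ p′ r′ n)))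

  negₚ-cong : ∀ {p p′} → p ≋ p′ → negₚ p ≋ negₚ p′
  negₚ-cong {p} {p′} e = pointwise λ n →
    trans (coeff-negₚ p n) (trans (cong -_ (at e n)) (sym (coeff-negₚ p′ n)))

  -ₚ-cong : ∀ {p p′ r r′} → p ≋ p′ → r ≋ r′ → p -ₚ r ≋ p′ -ₚ r′
  -ₚ-cong e f = +ₚ-cong e (negₚ-cong f)

  scaleₚ-cong : ∀ a {p p′} → p ≋ p′ → scaleₚ a p ≋ scaleₚ a p′
  scaleₚ-cong a {p} {p′} e = pointwise λ n →
    trans (coeff-scaleₚ a p n) (trans (cong (a *_) (at e n)) (sym (coeff-scaleₚ a p′ n)))

  +ₚ-congˡ : ∀ p {r r′} → r ≋ r′ → p +ₚ r ≋ p +ₚ r′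
  +ₚ-congˡ p = +ₚ-cong (≋-refl {p})

  +ₚ-congʳ : ∀ r {p p′} → p ≋ p′ → p +ₚ r ≋ p′ +ₚ r
  +ₚ-congʳ r e = +ₚ-cong e (≋-refl {r})

  +ₚ-assoc : ∀ p r s → (p +ₚ r) +ₚ s ≋ p +ₚ (r +ₚ s)
  +ₚ-assoc p r s = pointwise λ n → begin
    coeff ((p +ₚ r) +ₚ s) n              ≡⟨ trans (coeff-+ₚ (p +ₚ r) s n) (cong (_+ _) (coeff-+ₚ p r n)) ⟩
    (coeff p n + coeff r n) + coeff s n  ≡⟨ ℤ.+-assoc (coeff p n) _ _ ⟩
    coeff p n + (coeff r n + coeff s n)  ≡⟨ sym (trans (coeff-+ₚ p (r +ₚ s) n) (cong (coeff p n +_) (coeff-+ₚ r s n))) ⟩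
    coeff (p +ₚ (r +ₚ s)) n              ∎
    where open ≡-Reasoning

  +ₚ-comm : ∀ p r → p +ₚ r ≋ r +ₚ p
  +ₚ-comm p r = pointwise λ n →
    trans (coeff-+ₚ p r n) (trans (ℤ.+-comm (coeff p n) _) (sym (coeff-+ₚ r p n)))

  +ₚ-identityʳ : ∀ p → p +ₚ [] ≋ p
  +ₚ-identityʳ p = pointwise λ n → trans (coeff-+ₚ p [] n) (ℤ.+-identityʳ (coeff p n))

  negₚ-inverseˡ : ∀ p → negₚ p +ₚ p ≋ []
  negₚ-inverseˡ p = pointwise λ n →
    trans (coeff-+ₚ (negₚ p) p n) (trans (cong (_+ coeff p n) (coeff-negₚ p n)) (ℤ.+-inverseˡ (coeff p n)))

  negₚ-inverseʳ : ∀ p → p +ₚ negₚ p ≋ []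
  negₚ-inverseʳ p = ≋-trans (+ₚ-comm p (negₚ p)) (negₚ-inverseˡ p)

  +ₚ-interchange : ∀ p r s t → (p +ₚ r) +ₚ (s +ₚ t) ≋ (p +ₚ s) +ₚ (r +ₚ t)
  +ₚ-interchange p r s t = begin
    (p +ₚ r) +ₚ (s +ₚ t)  ≈⟨ +ₚ-assoc p r _ ⟩
    p +ₚ (r +ₚ (s +ₚ t))  ≈⟨ +ₚ-congˡ p (≋-sym (+ₚ-assoc r s t)) ⟩
    p +ₚ ((r +ₚ s) +ₚ t)  ≈⟨ +ₚ-congˡ p (+ₚ-congʳ t (+ₚ-comm r s)) ⟩
    p +ₚ ((s +ₚ r) +ₚ t)  ≈⟨ +ₚ-congˡ p (+ₚ-assoc s r t) ⟩
    p +ₚ (s +ₚ (r +ₚ t))  ≈⟨ ≋-sym (+ₚ-assoc p s _) ⟩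
    (p +ₚ s) +ₚ (r +ₚ t)  ∎
    where open ≋-Reasoning

  scaleₚ-distrib : ∀ a p r → scaleₚ a (p +ₚ r) ≋ scaleₚ a p +ₚ scaleₚ a r
  scaleₚ-distrib a p r = pointwise λ n → begin
    coeff (scaleₚ a (p +ₚ r)) n              ≡⟨ trans (coeff-scaleₚ a (p +ₚ r) n) (cong (a *_) (coeff-+ₚ p r n)) ⟩
    a * (coeff p n + coeff r n)              ≡⟨ ℤ.*-distribˡ-+ a (coeff p n) _ ⟩
    a * coeff p n + a * coeff r n
      ≡⟨ sym (trans (coeff-+ₚ (scaleₚ a p) _ n) (cong₂ _+_ (coeff-scaleₚ a p n) (coeff-scaleₚ a r n))) ⟩
    coeff (scaleₚ a p +ₚ scaleₚ a r) n       ∎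
    where open ≡-Reasoning

  scaleₚ-scaleₚ : ∀ a b p → scaleₚ (a * b) p ≋ scaleₚ a (scaleₚ b p)
  scaleₚ-scaleₚ a b p = pointwise λ n → begin
    coeff (scaleₚ (a * b) p) n      ≡⟨ coeff-scaleₚ (a * b) p n ⟩
    a * b * coeff p n               ≡⟨ ℤ.*-assoc a b _ ⟩
    a * (b * coeff p n)             ≡⟨ sym (trans (coeff-scaleₚ a (scaleₚ b p) n) (cong (a *_) (coeff-scaleₚ b p n))) ⟩
    coeff (scaleₚ a (scaleₚ b p)) n ∎
    where open ≡-Reasoning

  0∷[]≋[] : 0ℤ ∷ [] ≋ []
  0∷[]≋[] = pointwise λ { zero → refl ; (suc n) → refl }

  0∷-*ₚ : ∀ p r → (0ℤ ∷ p) *ₚ r ≋ 0ℤ ∷ p *ₚ r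
  0∷-*ₚ p r = pointwise λ n →
    trans (coeff-∷-*ₚ 0ℤ p r n)
          (trans (cong (_+ coeff (0ℤ ∷ p *ₚ r) n) (ℤ.*-zeroˡ (coeff r n))) (ℤ.+-identityˡ _))

  *ₚ-zeroʳ : ∀ p → p *ₚ [] ≋ []
  *ₚ-zeroʳ []      = ≋-refl
  *ₚ-zeroʳ (a ∷ p) = ≋-trans (∷-cong refl (*ₚ-zeroʳ p)) 0∷[]≋[]

  *ₚ-identityˡ : ∀ p → (1ℤ ∷ []) *ₚ p ≋ p
  *ₚ-identityˡ p = pointwise λ n → trans (coeff-∷-*ₚ 1ℤ [] p n) (one+0 n)
    where
    one+0 : ∀ n → 1ℤ * coeff p n + coeff (0ℤ ∷ []) n ≡ coeff p n
    one+0 zero    = trans (ℤ.+-identityʳ _) (ℤ.*-identityˡ _)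
    one+0 (suc n) = trans (ℤ.+-identityʳ _) (ℤ.*-identityˡ _)

  *ₚ-congʳ : ∀ p {r r′} → r ≋ r′ → p *ₚ r ≋ p *ₚ r′
  *ₚ-congʳ []      e = ≋-refl
  *ₚ-congʳ (a ∷ p) e = +ₚ-cong (scaleₚ-cong a e) (∷-cong refl (*ₚ-congʳ p e))

  *ₚ-∷ʳ : ∀ r a p → r *ₚ (a ∷ p) ≋ scaleₚ a r +ₚ (0ℤ ∷ r *ₚ p)
  *ₚ-∷ʳ []      a p = ≋-sym 0∷[]≋[]
  *ₚ-∷ʳ (b ∷ r) a p = ∷-cong (cong (_+ 0ℤ) (ℤ.*-comm b a)) (begin
    scaleₚ b p +ₚ r *ₚ (a ∷ p)                     ≈⟨ +ₚ-congˡ (scaleₚ b p) (*ₚ-∷ʳ r a p) ⟩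
    scaleₚ b p +ₚ (scaleₚ a r +ₚ (0ℤ ∷ r *ₚ p))    ≈⟨ ≋-sym (+ₚ-assoc (scaleₚ b p) _ _) ⟩
    (scaleₚ b p +ₚ scaleₚ a r) +ₚ (0ℤ ∷ r *ₚ p)    ≈⟨ +ₚ-congʳ (0ℤ ∷ r *ₚ p) (+ₚ-comm (scaleₚ b p) _) ⟩
    (scaleₚ a r +ₚ scaleₚ b p) +ₚ (0ℤ ∷ r *ₚ p)    ≈⟨ +ₚ-assoc (scaleₚ a r) _ _ ⟩
    scaleₚ a r +ₚ (scaleₚ b p +ₚ (0ℤ ∷ r *ₚ p))    ∎)
    where open ≋-Reasoning

  *ₚ-comm : ∀ p r → p *ₚ r ≋ r *ₚ p
  *ₚ-comm []      r = ≋-sym (*ₚ-zeroʳ r)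
  *ₚ-comm (a ∷ p) r = ≋-trans (+ₚ-congˡ (scaleₚ a r) (∷-cong refl (*ₚ-comm p r))) (≋-sym (*ₚ-∷ʳ r a p))

  *ₚ-cong : ∀ {p p′ r r′} → p ≋ p′ → r ≋ r′ → p *ₚ r ≋ p′ *ₚ r′
  *ₚ-cong {p} {p′} {r} {r′} e f = begin
    p *ₚ r    ≈⟨ *ₚ-congʳ p f ⟩
    p *ₚ r′   ≈⟨ *ₚ-comm p r′ ⟩
    r′ *ₚ p   ≈⟨ *ₚ-congʳ r′ e ⟩
    r′ *ₚ p′  ≈⟨ *ₚ-comm r′ p′ ⟩
    p′ *ₚ r′  ∎
    where open ≋-Reasoning

  *ₚ-distribˡ : ∀ p r s → p *ₚ (r +ₚ s) ≋ p *ₚ r +ₚ p *ₚ s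
  *ₚ-distribˡ []      r s = ≋-refl
  *ₚ-distribˡ (a ∷ p) r s = begin
    scaleₚ a (r +ₚ s) +ₚ (0ℤ ∷ p *ₚ (r +ₚ s))
      ≈⟨ +ₚ-cong (scaleₚ-distrib a r s) (∷-cong refl (*ₚ-distribˡ p r s)) ⟩
    (scaleₚ a r +ₚ scaleₚ a s) +ₚ ((0ℤ ∷ p *ₚ r) +ₚ (0ℤ ∷ p *ₚ s))
      ≈⟨ +ₚ-interchange (scaleₚ a r) _ _ _ ⟩
    (scaleₚ a r +ₚ (0ℤ ∷ p *ₚ r)) +ₚ (scaleₚ a s +ₚ (0ℤ ∷ p *ₚ s))  ∎
    where open ≋-Reasoning

  *ₚ-distribʳ : ∀ s p r → (p +ₚ r) *ₚ s ≋ p *ₚ s +ₚ r *ₚ s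
  *ₚ-distribʳ s p r = begin
    (p +ₚ r) *ₚ s        ≈⟨ *ₚ-comm (p +ₚ r) s ⟩
    s *ₚ (p +ₚ r)        ≈⟨ *ₚ-distribˡ s p r ⟩
    s *ₚ p +ₚ s *ₚ r     ≈⟨ +ₚ-cong (*ₚ-comm s p) (*ₚ-comm s r) ⟩
    p *ₚ s +ₚ r *ₚ s     ∎
    where open ≋-Reasoning

  scaleₚ-*ₚ : ∀ a r s → scaleₚ a r *ₚ s ≋ scaleₚ a (r *ₚ s)
  scaleₚ-*ₚ a []      s = ≋-refl
  scaleₚ-*ₚ a (b ∷ r) s = begin
    scaleₚ (a * b) s +ₚ (0ℤ ∷ scaleₚ a r *ₚ s)
      ≈⟨ +ₚ-cong (scaleₚ-scaleₚ a b s) (∷-cong (sym (ℤ.*-zeroʳ a)) (scaleₚ-*ₚ a r s)) ⟩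
    scaleₚ a (scaleₚ b s) +ₚ scaleₚ a (0ℤ ∷ r *ₚ s)
      ≈⟨ ≋-sym (scaleₚ-distrib a (scaleₚ b s) _) ⟩
    scaleₚ a (scaleₚ b s +ₚ (0ℤ ∷ r *ₚ s))  ∎
    where open ≋-Reasoning

  *ₚ-assoc : ∀ p r s → (p *ₚ r) *ₚ s ≋ p *ₚ (r *ₚ s)
  *ₚ-assoc []      r s = ≋-refl
  *ₚ-assoc (a ∷ p) r s = begin
    (scaleₚ a r +ₚ (0ℤ ∷ p *ₚ r)) *ₚ s          ≈⟨ *ₚ-distribʳ s (scaleₚ a r) _ ⟩
    scaleₚ a r *ₚ s +ₚ (0ℤ ∷ p *ₚ r) *ₚ s       ≈⟨ +ₚ-cong (scaleₚ-*ₚ a r s) (0∷-*ₚ (p *ₚ r) s) ⟩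
    scaleₚ a (r *ₚ s) +ₚ (0ℤ ∷ (p *ₚ r) *ₚ s)   ≈⟨ +ₚ-congˡ (scaleₚ a (r *ₚ s)) (∷-cong refl (*ₚ-assoc p r s)) ⟩
    scaleₚ a (r *ₚ s) +ₚ (0ℤ ∷ p *ₚ (r *ₚ s))   ∎
    where open ≋-Reasoning

  ℤ[q] : CommutativeRing 0ℓ 0ℓ
  ℤ[q] = record
    { Carrier = Poly ; _≈_ = _≋_ ; _+_ = _+ₚ_ ; _*_ = _*ₚ_ ; -_ = negₚ ; 0# = [] ; 1# = 1ℤ ∷ []
    ; isCommutativeRing = record
      { isRing = record
        { +-isAbelianGroup = record
          { isGroup = record
            { isMonoid = record
              { isSemigroup = record
                { isMagma = record { isEquivalence = Setoid.isEquivalence ≋-setoid ; ∙-cong = +ₚ-cong }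
                ; assoc   = +ₚ-assoc
                }
              ; identity = (λ _ → ≋-refl) , +ₚ-identityʳ
              }
            ; inverse = negₚ-inverseˡ , negₚ-inverseʳ
            ; ⁻¹-cong = negₚ-cong
            }
          ; comm = +ₚ-comm
          }
        ; *-cong     = *ₚ-cong
        ; *-assoc    = *ₚ-assoc
        ; *-identity = *ₚ-identityˡ , λ p → ≋-trans (*ₚ-comm p _) (*ₚ-identityˡ p)
        ; distrib    = *ₚ-distribˡ , *ₚ-distribʳ
        }
      ; *-comm = *ₚ-comm
      }
    }

  constₚ-homomorphism : +-*-rawRing ACR.-Raw-AlmostCommutative⟶ ACR.fromCommutativeRing ℤ[q]
  constₚ-homomorphism = record
    { ⟦_⟧    = _∷ []
    ; +-homo = λ _ _ → ∷-cong refl ≋-refl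
    ; *-homo = λ a b → pointwise λ { zero → sym (ℤ.+-identityʳ (a * b)) ; (suc n) → refl }
    ; -‿homo = λ _ → ∷-cong refl ≋-refl
    ; 0-homo = 0∷[]≋[]
    ; 1-homo = ≋-refl
    }

  constₚ-≟ : ∀ a b → Maybe ((a ∷ []) ≋ (b ∷ []))
  constₚ-≟ a b with a ℤ.≟ b
  ... | yes refl = just ≋-refl
  ... | no _     = nothing

  open Algebra.Solver.Ring +-*-rawRing (ACR.fromCommutativeRing ℤ[q]) constₚ-homomorphism constₚ-≟ public
    using (solve; _:+_; _:-_; _:*_; _:=_; con)

module Coefficients where

  open import Defs
  open PolyRing
  open import Data.Nat as ℕ using (ℕ; zero; suc; z≤n; s≤s)
  import Data.Nat.Properties as ℕ
  open import Data.Integer using (+_; 0ℤ; 1ℤ; _+_; _*_)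
  import Data.Integer as ℤ using (_<_; +<+)
  import Data.Integer.Properties as ℤ
  open import Data.List using ([]; _∷_)
  open import Data.Product using (∃-syntax; _,_; _×_; proj₁; proj₂)
  open import Data.Sum using (_⊎_; inj₁; inj₂)
  open import Data.Empty using (⊥-elim)
  open import Relation.Binary.PropositionalEquality
  open import Relation.Nullary using (yes; no)
  open import Function using (_∘_)

  coeff-qpow-≢ : ∀ e j → j ≢ e → coeff (qpow e) j ≡ 0ℤ
  coeff-qpow-≢ zero    zero    j≢e = ⊥-elim (j≢e refl)
  coeff-qpow-≢ zero    (suc j) j≢e = refl
  coeff-qpow-≢ (suc e) zero    j≢e = refl
  coeff-qpow-≢ (suc e) (suc j) j≢e = coeff-qpow-≢ e j (j≢e ∘ cong suc)

  coeff-qpow-≡ : ∀ e → coeff (qpow e) e ≡ 1ℤ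
  coeff-qpow-≡ zero    = refl
  coeff-qpow-≡ (suc e) = coeff-qpow-≡ e

  qpow-*ₚ-qpow : ∀ a b → qpow a *ₚ qpow b ≋ qpow (a ℕ.+ b)
  qpow-*ₚ-qpow zero    b = *ₚ-identityˡ (qpow b)
  qpow-*ₚ-qpow (suc a) b = ≋-trans (0∷-*ₚ (qpow a) (qpow b)) (∷-cong refl (qpow-*ₚ-qpow a b))

  coeff-qint-≥ : ∀ a n → a ℕ.≤ n → coeff (qint a) n ≡ 0ℤ
  coeff-qint-≥ zero    n       _         = refl
  coeff-qint-≥ (suc a) (suc n) (s≤s a≤n) = coeff-qint-≥ a n a≤n

  qint-suc : ∀ m → 1ℤ ∷ qint m ≋ qint m +ₚ qpow m
  qint-suc zero    = ≋-refl
  qint-suc (suc m) = ∷-cong refl (qint-suc m)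

  qint-suc-suc : ∀ m → qint (suc (suc m)) ≋ (1ℤ ∷ []) +ₚ (0ℤ ∷ qint m) +ₚ qpow (suc m)
  qint-suc-suc m = ∷-cong refl (qint-suc m)

  NonNegCoeffs : Poly → Set
  NonNegCoeffs p = ∀ n → ∃[ k ] coeff p n ≡ + k

  NonNegCoeffs-≋ : ∀ {p r} → p ≋ r → NonNegCoeffs p → NonNegCoeffs r
  NonNegCoeffs-≋ p≋r p≥0 n = proj₁ (p≥0 n) , trans (sym (at p≋r n)) (proj₂ (p≥0 n))

  NonNegCoeffs-∷ : ∀ k p → NonNegCoeffs p → NonNegCoeffs (+ k ∷ p)
  NonNegCoeffs-∷ k p p≥0 zero    = k , refl
  NonNegCoeffs-∷ k p p≥0 (suc n) = p≥0 n

  NonNegCoeffs-+ₚ : ∀ p r → NonNegCoeffs p → NonNegCoeffs r → NonNegCoeffs (p +ₚ r)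
  NonNegCoeffs-+ₚ p r p≥0 r≥0 n with p≥0 n | r≥0 n
  ... | k , pₙ≡k | l , rₙ≡l = k ℕ.+ l , trans (coeff-+ₚ p r n) (cong₂ _+_ pₙ≡k rₙ≡l)

  NonNegCoeffs-*ₚ : ∀ p r → NonNegCoeffs p → NonNegCoeffs r → NonNegCoeffs (p *ₚ r)
  NonNegCoeffs-*ₚ []      r p≥0 r≥0 n = 0 , refl
  NonNegCoeffs-*ₚ (a ∷ p) r p≥0 r≥0 with p≥0 zero
  ... | k , refl = NonNegCoeffs-+ₚ (scaleₚ (+ k) r) _ scaled
                     (NonNegCoeffs-∷ 0 (p *ₚ r) (NonNegCoeffs-*ₚ p r (p≥0 ∘ suc) r≥0))
    where
    scaled : NonNegCoeffs (scaleₚ (+ k) r)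
    scaled n with r≥0 n
    ... | l , rₙ≡l = k ℕ.* l , trans (coeff-scaleₚ (+ k) r n) (trans (cong (+ k *_) rₙ≡l) (sym (ℤ.pos-* k l)))

  NonNegCoeffs-qpow : ∀ e → NonNegCoeffs (qpow e)
  NonNegCoeffs-qpow zero    = NonNegCoeffs-∷ 1 [] λ _ → 0 , refl
  NonNegCoeffs-qpow (suc e) = NonNegCoeffs-∷ 0 (qpow e) (NonNegCoeffs-qpow e)

  NonNegCoeffs-qint : ∀ a → NonNegCoeffs (qint a)
  NonNegCoeffs-qint zero    = λ _ → 0 , refl
  NonNegCoeffs-qint (suc a) = NonNegCoeffs-∷ 1 (qint a) (NonNegCoeffs-qint a)

  NonNegCoeffs⇒PositiveCoeffs : ∀ p → NonNegCoeffs p → PositiveCoeffs p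
  NonNegCoeffs⇒PositiveCoeffs p p≥0 n with p≥0 n
  ... | zero  , pₙ≡0   = inj₁ pₙ≡0
  ... | suc k , pₙ≡1+k = inj₂ (subst (0ℤ ℤ.<_) (sym pₙ≡1+k) (ℤ.+<+ (s≤s z≤n)))

  DegreeAtMost : Poly → ℕ → Set
  DegreeAtMost p m = ∀ j → m ℕ.< j → coeff p j ≡ 0ℤ

  VanishesBelow : Poly → ℕ → Set
  VanishesBelow p l = ∀ j → j ℕ.< l → coeff p j ≡ 0ℤ

  DegreeAtMost-≋ : ∀ {p r m} → p ≋ r → DegreeAtMost p m → DegreeAtMost r m
  DegreeAtMost-≋ p≋r deg j m<j = trans (sym (at p≋r j)) (deg j m<j)

  DegreeAtMost-mono : ∀ p {m n} → m ℕ.≤ n → DegreeAtMost p m → DegreeAtMost p n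
  DegreeAtMost-mono p m≤n deg j n<j = deg j (ℕ.≤-<-trans m≤n n<j)

  DegreeAtMost-+ₚ : ∀ p r {m} → DegreeAtMost p m → DegreeAtMost r m → DegreeAtMost (p +ₚ r) m
  DegreeAtMost-+ₚ p r degp degr j m<j = trans (coeff-+ₚ p r j) (cong₂ _+_ (degp j m<j) (degr j m<j))

  DegreeAtMost-qpow : ∀ e → DegreeAtMost (qpow e) e
  DegreeAtMost-qpow e j e<j = coeff-qpow-≢ e j (ℕ.>⇒≢ e<j)

  private
    shifted-tail-*ₚ≋[] : ∀ {a p} r → DegreeAtMost (a ∷ p) 0 → 0ℤ ∷ p *ₚ r ≋ []
    shifted-tail-*ₚ≋[] {p = p} r deg = ≋-trans (∷-cong refl (*ₚ-cong p≋[] (≋-refl {r}))) 0∷[]≋[]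
      where
      p≋[] : p ≋ []
      p≋[] = pointwise λ j → deg (suc j) (s≤s z≤n)

  DegreeAtMost-*ₚ : ∀ p r {m n} → DegreeAtMost p m → DegreeAtMost r n → DegreeAtMost (p *ₚ r) (m ℕ.+ n)
  DegreeAtMost-*ₚ []      r degp degr j _ = refl
  DegreeAtMost-*ₚ (a ∷ p) r {m} {n} degp degr j m+n<j =
    trans (coeff-∷-*ₚ a p r j) (cong₂ _+_ (trans (cong (a *_) (degr j n<j)) (ℤ.*-zeroʳ a)) (shifted m j degp m+n<j))
    where
    n<j = ℕ.≤-<-trans (ℕ.m≤n+m n m) m+n<j
    shifted : ∀ m j → DegreeAtMost (a ∷ p) m → m ℕ.+ n ℕ.< j → coeff (0ℤ ∷ p *ₚ r) j ≡ 0ℤ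
    shifted zero    j       degp _           = at (shifted-tail-*ₚ≋[] r degp) j
    shifted (suc m) (suc j) degp (s≤s m+n<j) =
      DegreeAtMost-*ₚ p r (λ i m<i → degp (suc i) (s≤s m<i)) degr j m+n<j

  coeff-*ₚ-top : ∀ p r {m n} → DegreeAtMost p m → DegreeAtMost r n →
                 coeff (p *ₚ r) (m ℕ.+ n) ≡ coeff p m * coeff r n
  coeff-*ₚ-top []      r {n = n} degp degr = sym (ℤ.*-zeroˡ (coeff r n))
  coeff-*ₚ-top (a ∷ p) r {zero} {n} degp degr =
    trans (coeff-∷-*ₚ a p r n) (trans (cong (_+_ (a * coeff r n)) (at (shifted-tail-*ₚ≋[] r degp) n)) (ℤ.+-identityʳ _))
  coeff-*ₚ-top (a ∷ p) r {suc m} {n} degp degr = begin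
    coeff ((a ∷ p) *ₚ r) (suc (m ℕ.+ n))              ≡⟨ coeff-∷-*ₚ a p r (suc (m ℕ.+ n)) ⟩
    a * coeff r (suc (m ℕ.+ n)) + coeff (p *ₚ r) (m ℕ.+ n)
      ≡⟨ cong₂ _+_ (trans (cong (a *_) (degr _ (s≤s (ℕ.m≤n+m n m)))) (ℤ.*-zeroʳ a))
                   (coeff-*ₚ-top p r (λ i m<i → degp (suc i) (s≤s m<i)) degr) ⟩
    0ℤ + coeff p m * coeff r n                         ≡⟨ ℤ.+-identityˡ _ ⟩
    coeff p m * coeff r n                              ∎
    where open ≡-Reasoning

  VanishesBelow-*ₚ : ∀ p r {l} → VanishesBelow r l → VanishesBelow (p *ₚ r) l
  VanishesBelow-*ₚ []      r low j _   = refl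
  VanishesBelow-*ₚ (a ∷ p) r {l} low j j<l =
    trans (coeff-∷-*ₚ a p r j) (cong₂ _+_ (trans (cong (a *_) (low j j<l)) (ℤ.*-zeroʳ a)) (shifted j j<l))
    where
    shifted : ∀ j → j ℕ.< l → coeff (0ℤ ∷ p *ₚ r) j ≡ 0ℤ
    shifted zero    _   = refl
    shifted (suc j) j<l = VanishesBelow-*ₚ p r low j (ℕ.<-trans (ℕ.n<1+n j) j<l)

  coeff-*ₚ-bottom : ∀ p r {l} → VanishesBelow r l → coeff (p *ₚ r) l ≡ coeff p 0 * coeff r l
  coeff-*ₚ-bottom []      r {l} low = sym (ℤ.*-zeroˡ (coeff r l))
  coeff-*ₚ-bottom (a ∷ p) r {zero}  low = trans (coeff-∷-*ₚ a p r 0) (ℤ.+-identityʳ _)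
  coeff-*ₚ-bottom (a ∷ p) r {suc l} low = trans (coeff-∷-*ₚ a p r (suc l))
    (trans (cong (_+_ (a * coeff r (suc l))) (VanishesBelow-*ₚ p r low l (ℕ.n<1+n l))) (ℤ.+-identityʳ _))

  zero⊎degree : ∀ p → p ≋ [] ⊎ ∃[ m ] (coeff p m ≢ 0ℤ × DegreeAtMost p m)
  zero⊎degree []      = inj₁ ≋-refl
  zero⊎degree (a ∷ p) with zero⊎degree p
  ... | inj₂ (m , pₘ≢0 , deg) = inj₂ (suc m , pₘ≢0 , λ { (suc j) (s≤s m<j) → deg j m<j })
  ... | inj₁ p≋[] with a ℤ.≟ 0ℤ
  ...   | yes a≡0 = inj₁ (pointwise λ { zero → a≡0 ; (suc j) → at p≋[] j })
  ...   | no  a≢0 = inj₂ (0 , a≢0 , λ { (suc j) _ → at p≋[] j })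

  zero⊎order : ∀ p → p ≋ [] ⊎ ∃[ l ] (coeff p l ≢ 0ℤ × VanishesBelow p l)
  zero⊎order []      = inj₁ ≋-refl
  zero⊎order (a ∷ p) with a ℤ.≟ 0ℤ
  ... | no  a≢0 = inj₂ (0 , a≢0 , λ _ ())
  ... | yes a≡0 with zero⊎order p
  ...   | inj₁ p≋[]             = inj₁ (pointwise λ { zero → a≡0 ; (suc j) → at p≋[] j })
  ...   | inj₂ (l , pₗ≢0 , low) = inj₂ (suc l , pₗ≢0 , λ { zero _ → a≡0 ; (suc j) (s≤s j<l) → low j j<l })

module Divisibility where

  open import Defs
  open PolyRing
  open Coefficients
  open import Data.Nat as ℕ using (zero; suc; z≤n; s≤s)
  import Data.Nat.Properties as ℕ
  open import Data.Integer using (+_; -[1+_]; 0ℤ; 1ℤ; -1ℤ; _*_; ∣_∣)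
  import Data.Integer.Properties as ℤ
  open import Data.List using ([]; _∷_)
  open import Data.Product using (_,_)
  open import Data.Sum using (_⊎_; inj₁; inj₂)
  open import Data.Empty using (⊥; ⊥-elim)
  open import Relation.Binary.PropositionalEquality
  open import Relation.Nullary using (yes; no)

  private
    1≢0 : 1ℤ ≢ 0ℤ
    1≢0 ()

    -1≢0 : -1ℤ ≢ 0ℤ
    -1≢0 ()

    *-≢0 : ∀ x y → x ≢ 0ℤ → y ≢ 0ℤ → x * y ≢ 0ℤ
    *-≢0 x y x≢0 y≢0 xy≡0 with ℤ.i*j≡0⇒i≡0∨j≡0 x xy≡0
    ... | inj₁ x≡0 = x≢0 x≡0
    ... | inj₂ y≡0 = y≢0 y≡0

    qpow≉0 : ∀ {d a} e → d *ₚ a ≋ qpow e → a ≋ [] → ⊥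
    qpow≉0 {d} {a} e da≋qᵉ a≋[] = 1≢0 (begin
      1ℤ                ≡⟨ sym (coeff-qpow-≡ e) ⟩
      coeff (qpow e) e  ≡⟨ sym (at da≋qᵉ e) ⟩
      coeff (d *ₚ a) e  ≡⟨ at (≋-trans (*ₚ-cong (≋-refl {d}) a≋[]) (*ₚ-zeroʳ d)) e ⟩
      0ℤ                ∎)
      where open ≡-Reasoning

  coeff-qpow-≢0⇒≡ : ∀ e j → coeff (qpow e) j ≢ 0ℤ → j ≡ e
  coeff-qpow-≢0⇒≡ e j qⱼ≢0 with j ℕ.≟ e
  ... | yes j≡e = j≡e
  ... | no  j≢e = ⊥-elim (qⱼ≢0 (coeff-qpow-≢ e j j≢e))

  -- The top coefficient of d a sits at deg d + deg a and its bottom one at ord a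
  -- (as d₀ ≠ 0); both must be e, and ord a ≤ deg a, so deg d = 0.
  divisor-of-qpow-constant : ∀ d a e → d *ₚ a ≋ qpow e → coeff d 0 ≢ 0ℤ → DegreeAtMost d 0
  divisor-of-qpow-constant d a e da≋qᵉ d₀≢0 with zero⊎degree d | zero⊎degree a | zero⊎order a
  ... | inj₁ d≋[] | _ | _ = ⊥-elim (d₀≢0 (at d≋[] 0))
  ... | _ | inj₁ a≋[] | _ = ⊥-elim (qpow≉0 {d} e da≋qᵉ a≋[])
  ... | _ | _ | inj₁ a≋[] = ⊥-elim (qpow≉0 {d} e da≋qᵉ a≋[])
  ... | inj₂ (m , dₘ≢0 , degd) | inj₂ (n , aₙ≢0 , dega) | inj₂ (l , aₗ≢0 , lowa) =
    λ j 0<j → degd j (subst (ℕ._< j) (sym m≡0) 0<j)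
    where
    m+n≡e : m ℕ.+ n ≡ e
    m+n≡e = coeff-qpow-≢0⇒≡ e (m ℕ.+ n)
      (subst (_≢ 0ℤ) (trans (sym (coeff-*ₚ-top d a degd dega)) (at da≋qᵉ (m ℕ.+ n))) (*-≢0 _ _ dₘ≢0 aₙ≢0))
    l≡e : l ≡ e
    l≡e = coeff-qpow-≢0⇒≡ e l
      (subst (_≢ 0ℤ) (trans (sym (coeff-*ₚ-bottom d a lowa)) (at da≋qᵉ l)) (*-≢0 _ _ d₀≢0 aₗ≢0))
    l≤n : l ℕ.≤ n
    l≤n = ℕ.≮⇒≥ λ n<l → aₗ≢0 (dega l n<l)
    m≡0 : m ≡ 0
    m≡0 = ℕ.n≤0⇒n≡0 (ℕ.+-cancelʳ-≤ n m 0 (subst (ℕ._≤ n) (trans l≡e (sym m+n≡e)) l≤n))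

  *≡1⇒≡±1 : ∀ x y → x * y ≡ 1ℤ → x ≡ 1ℤ ⊎ x ≡ -1ℤ
  *≡1⇒≡±1 x y xy≡1 with ℕ.m*n≡1⇒m≡1 ∣ x ∣ ∣ y ∣ (trans (sym (ℤ.abs-* x y)) (cong ∣_∣ xy≡1))
  *≡1⇒≡±1 (+ 1)     y _ | refl = inj₁ refl
  *≡1⇒≡±1 -[1+ 0 ] y _ | refl = inj₂ refl

  constant≈ₚ : ∀ d {c} → DegreeAtMost d 0 → coeff d 0 ≡ c → d ≈ₚ c ∷ []
  constant≈ₚ d deg d₀≡c zero    = d₀≡c
  constant≈ₚ d deg d₀≡c (suc j) = deg (suc j) (s≤s z≤n)

  -- A common divisor d of x and u divides the monomial x v − y u, and d₀ a₀ = x₀ = 1 forces d₀ = ±1.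
  coprime-of-det≋qpow : ∀ x y u v e → x *ₚ v -ₚ y *ₚ u ≋ qpow e → coeff x 0 ≡ 1ℤ → Coprime x u
  coprime-of-det≋qpow x y u v e det≋qᵉ x₀≡1 d (a , x≈da) (b , u≈db) =
    unit (*≡1⇒≡±1 (coeff d 0) (coeff a 0) d₀a₀≡1)
    where
    d₀a₀≡1 : coeff d 0 * coeff a 0 ≡ 1ℤ
    d₀a₀≡1 = trans (sym (coeff-*ₚ-bottom d a {0} λ _ ())) (trans (sym (x≈da 0)) x₀≡1)

    d-divides-qᵉ : d *ₚ (a *ₚ v -ₚ y *ₚ b) ≋ qpow e
    d-divides-qᵉ = begin
      d *ₚ (a *ₚ v -ₚ y *ₚ b)          ≈⟨ solve 5 (λ d a b v y → d :* (a :* v :- y :* b) := (d :* a) :* v :- y :* (d :* b))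
                                                  ≋-refl d a b v y ⟩
      (d *ₚ a) *ₚ v -ₚ y *ₚ (d *ₚ b)   ≈⟨ -ₚ-cong (*ₚ-cong (≋-sym x≋da) (≋-refl {v})) (*ₚ-cong (≋-refl {y}) (≋-sym u≋db)) ⟩
      x *ₚ v -ₚ y *ₚ u                 ≈⟨ det≋qᵉ ⟩
      qpow e                           ∎
      where
      open ≋-Reasoning
      x≋da : x ≋ d *ₚ a
      x≋da = pointwise x≈da
      u≋db : u ≋ d *ₚ b
      u≋db = pointwise u≈db

    d-constant : coeff d 0 ≢ 0ℤ → DegreeAtMost d 0
    d-constant = divisor-of-qpow-constant d _ e d-divides-qᵉ

    unit : coeff d 0 ≡ 1ℤ ⊎ coeff d 0 ≡ -1ℤ → IsUnit d
    unit (inj₁ d₀≡1)  = inj₁ (constant≈ₚ d (d-constant λ d₀≡0 → 1≢0 (trans (sym d₀≡1) d₀≡0)) d₀≡1)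
    unit (inj₂ d₀≡-1) = inj₂ (constant≈ₚ d (d-constant λ d₀≡0 → -1≢0 (trans (sym d₀≡-1) d₀≡0)) d₀≡-1)

module Exponents where

  open import Defs
  open import Data.Nat using (zero; suc; _+_; _∸_; _≤_)
  open import Data.Nat.Properties using (+-assoc; +-comm; +-identityʳ; +-suc; m+n∸n≡m; m+[n∸m]≡n)
  open import Data.Nat.Solver using (module +-*-Solver)
  open import Relation.Binary.PropositionalEquality
  open +-*-Solver

  sumFrom-suc : ∀ c a n → sumFrom c a (suc n) ≡ sumFrom c a n + c (a + n)
  sumFrom-suc c a zero    = trans (+-identityʳ (c a)) (cong c (sym (+-identityʳ a)))
  sumFrom-suc c a (suc n) = begin
    c a + sumFrom c (suc a) (suc n)                ≡⟨ cong (c a +_) (sumFrom-suc c (suc a) n) ⟩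
    c a + (sumFrom c (suc a) n + c (suc a + n))    ≡⟨ sym (+-assoc (c a) _ _) ⟩
    c a + sumFrom c (suc a) n + c (suc (a + n))    ≡⟨ cong (λ i → c a + sumFrom c (suc a) n + c i) (sym (+-suc a n)) ⟩
    sumFrom c a (suc n) + c (a + suc n)            ∎
    where open ≡-Reasoning

  +-pred-+-suc : ∀ m n {C} → 1 ≤ C → m + (C ∸ 1) + suc n ≡ m + n + C
  +-pred-+-suc m n {C} 1≤C = trans (solve 3 (λ m x n → m :+ x :+ (con 1 :+ n) := m :+ n :+ (con 1 :+ x)) refl m (C ∸ 1) n)
                                 (cong (m + n +_) (m+[n∸m]≡n 1≤C))

  m+n≡o⇒m≡o∸n : ∀ {m n o} → m + n ≡ o → m ≡ o ∸ n
  m+n≡o⇒m≡o∸n {m} {n} eq = trans (sym (m+n∸n≡m m n)) (cong (_∸ n) eq)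

  R-exponent : ∀ c {D j} → 1 ≤ c 1 → D + j ≡ (c 1 ∸ 1) + sumFrom c 2 j → D ≡ sumFrom c 1 (suc j) ∸ suc j
  R-exponent c {D} {j} 1≤c₁ eq =
    m+n≡o⇒m≡o∸n (trans (+-suc D j) (trans (cong suc eq) (cong (_+ sumFrom c 2 j) (m+[n∸m]≡n 1≤c₁))))

  S-exponent : ∀ c {D j} → D + j ≡ sumFrom c 2 j → D ≡ sumFrom c 2 j + 1 ∸ suc j
  S-exponent c {D} {j} eq = m+n≡o⇒m≡o∸n (trans (+-suc D j) (trans (cong suc eq) (+-comm 1 (sumFrom c 2 j))))

module Recurrence where

  open import Defs
  open PolyRing
  open Coefficients
  open Divisibility using (coprime-of-det≋qpow)
  open Exponents
  open import Data.Nat as ℕ using (ℕ; zero; suc; _∸_; z≤n; s≤s)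
  import Data.Nat.Properties as ℕ
  open import Data.Integer using (0ℤ; 1ℤ; _+_; _*_)
  import Data.Integer.Properties as ℤ
  open import Data.List using ([]; _∷_)
  open import Data.Product using (∃-syntax; _,_; _×_)
  open import Relation.Binary.PropositionalEquality
  open Pair

  record Admissible (p : Poly) (D : ℕ) : Set where
    field
      nonNeg   : NonNegCoeffs p
      degree   : DegreeAtMost p D
      constant : coeff p 0 ≡ 1ℤ

  Admissible-≋ : ∀ {p r D} → p ≋ r → Admissible p D → Admissible r D
  Admissible-≋ p≋r A = record
    { nonNeg   = NonNegCoeffs-≋ p≋r nonNeg
    ; degree   = DegreeAtMost-≋ p≋r degree
    ; constant = trans (sym (at p≋r 0)) constant
    }
    where open Admissible A

  Admissible-+ₚ : ∀ p r {D} → Admissible p D → NonNegCoeffs r → DegreeAtMost r D → coeff r 0 ≡ 0ℤ →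
                  Admissible (p +ₚ r) D
  Admissible-+ₚ p r A r≥0 degr r₀≡0 = record
    { nonNeg   = NonNegCoeffs-+ₚ p r nonNeg r≥0
    ; degree   = DegreeAtMost-+ₚ p r degree degr
    ; constant = trans (coeff-+ₚ p r 0) (cong₂ _+_ constant r₀≡0)
    }
    where open Admissible A

  Admissible-mono : ∀ {p D D′} → D ℕ.≤ D′ → Admissible p D → Admissible p D′
  Admissible-mono {p} D≤D′ A = record { nonNeg = nonNeg ; degree = DegreeAtMost-mono p D≤D′ degree ; constant = constant }
    where open Admissible A

  -- (x , y) = (X_{i−1} , X_i), Q = c_i − 1 and D = deg X_i.
  record Invariant (Q : ℕ) (x y : Poly) (D : ℕ) : Set where
    field
      admissible     : Admissible y D
      leading        : coeff y D ≡ 1ℤ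
      gap-admissible : Admissible (y -ₚ qpow Q *ₚ x) D

  -- With [m+2] = 1 + q[m] + q^(m+1), the new gap is the old one plus q[m] y,
  -- and the new term is the new gap plus q^(m+1) y, whose leading term is q^(D+m+1).
  Invariant-step : ∀ {Q x y D} C → 2 ℕ.≤ C → Invariant Q x y D →
                   Invariant (C ∸ 1) y (qint C *ₚ y -ₚ qpow Q *ₚ x) (D ℕ.+ (C ∸ 1))
  Invariant-step (suc zero) (s≤s ())
  Invariant-step {Q} {x} {y} {D} (suc (suc m)) _ I = record
    { admissible     = Admissible-≋ (≋-sym z≋gap′+yqᵐ⁺¹) z-admissible
    ; leading        = z-leading
    ; gap-admissible = Admissible-mono (ℕ.+-monoʳ-≤ D (ℕ.n≤1+n m)) gap′-admissible
    }
    where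
    open Invariant I
    open Admissible admissible using () renaming (nonNeg to y-nonNeg; degree to y-degree)
    T    = 0ℤ ∷ qint m
    qᵐ⁺¹ = qpow (suc m)
    gap  = y -ₚ qpow Q *ₚ x
    z    = qint (suc (suc m)) *ₚ y -ₚ qpow Q *ₚ x
    gap′ = z -ₚ qᵐ⁺¹ *ₚ y

    gap′≋gap+Ty : gap′ ≋ gap +ₚ T *ₚ y
    gap′≋gap+Ty = begin
      gap′
        ≈⟨ -ₚ-cong (-ₚ-cong (*ₚ-cong (qint-suc-suc m) (≋-refl {y})) (≋-refl {qpow Q *ₚ x})) (≋-refl {qᵐ⁺¹ *ₚ y}) ⟩
      ((1ℤ ∷ []) +ₚ T +ₚ qᵐ⁺¹) *ₚ y -ₚ qpow Q *ₚ x -ₚ qᵐ⁺¹ *ₚ y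
        ≈⟨ solve 4 (λ T P y Qx → (con 1ℤ :+ T :+ P) :* y :- Qx :- P :* y := y :- Qx :+ T :* y)
                   ≋-refl T qᵐ⁺¹ y (qpow Q *ₚ x) ⟩
      gap +ₚ T *ₚ y
        ∎
      where open ≋-Reasoning

    z≋gap′+yqᵐ⁺¹ : z ≋ gap′ +ₚ y *ₚ qᵐ⁺¹
    z≋gap′+yqᵐ⁺¹ = solve 3 (λ z P y → z := (z :- P :* y) :+ y :* P) ≋-refl z qᵐ⁺¹ y

    deg-T : DegreeAtMost T m
    deg-T (suc j) (s≤s m≤j) = coeff-qint-≥ m j m≤j

    gap′-admissible : Admissible gap′ (D ℕ.+ m)
    gap′-admissible = Admissible-≋ (≋-sym gap′≋gap+Ty)
      (Admissible-+ₚ gap (T *ₚ y) (Admissible-mono (ℕ.m≤m+n D m) gap-admissible)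
        (NonNegCoeffs-*ₚ T y (NonNegCoeffs-∷ 0 (qint m) (NonNegCoeffs-qint m)) y-nonNeg)
        (DegreeAtMost-mono (T *ₚ y) (ℕ.≤-reflexive (ℕ.+-comm m D)) (DegreeAtMost-*ₚ T y deg-T y-degree))
        (trans (coeff-*ₚ-bottom T y {0} λ _ ()) (ℤ.*-zeroˡ (coeff y 0))))

    z-admissible : Admissible (gap′ +ₚ y *ₚ qᵐ⁺¹) (D ℕ.+ suc m)
    z-admissible = Admissible-+ₚ gap′ (y *ₚ qᵐ⁺¹)
      (Admissible-mono (ℕ.+-monoʳ-≤ D (ℕ.n≤1+n m)) gap′-admissible)
      (NonNegCoeffs-*ₚ y qᵐ⁺¹ y-nonNeg (NonNegCoeffs-qpow (suc m)))
      (DegreeAtMost-*ₚ y qᵐ⁺¹ y-degree (DegreeAtMost-qpow (suc m)))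
      (trans (coeff-*ₚ-bottom y qᵐ⁺¹ {0} λ _ ()) (ℤ.*-zeroʳ (coeff y 0)))

    z-leading : coeff z (D ℕ.+ suc m) ≡ 1ℤ
    z-leading = begin
      coeff z (D ℕ.+ suc m)                                     ≡⟨ at z≋gap′+yqᵐ⁺¹ _ ⟩
      coeff (gap′ +ₚ y *ₚ qᵐ⁺¹) (D ℕ.+ suc m)                   ≡⟨ coeff-+ₚ gap′ _ _ ⟩
      coeff gap′ (D ℕ.+ suc m) + coeff (y *ₚ qᵐ⁺¹) (D ℕ.+ suc m)
        ≡⟨ cong₂ _+_ (Admissible.degree gap′-admissible _ (ℕ.+-monoʳ-< D (ℕ.n<1+n m)))
                     (coeff-*ₚ-top y qᵐ⁺¹ y-degree (DegreeAtMost-qpow (suc m))) ⟩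
      0ℤ + coeff y D * coeff qᵐ⁺¹ (suc m)
        ≡⟨ cong₂ (λ a b → 0ℤ + a * b) leading (coeff-qpow-≡ (suc m)) ⟩
      1ℤ                                                        ∎
      where open ≡-Reasoning

  Invariant-init : ∀ Q → Invariant Q [] (1ℤ ∷ []) 0
  Invariant-init Q = record
    { admissible     = one-admissible
    ; leading        = refl
    ; gap-admissible = Admissible-≋ (-ₚ-cong (≋-refl {1ℤ ∷ []}) (≋-sym (*ₚ-zeroʳ (qpow Q)))) one-admissible
    }
    where
    one-admissible : Admissible (1ℤ ∷ []) 0
    one-admissible = record
      { nonNeg = NonNegCoeffs-qpow 0 ; degree = DegreeAtMost-qpow 0 ; constant = refl }

  Invariant-≋ : ∀ {Q x y y′ D} → y ≋ y′ → Invariant Q x y D → Invariant Q x y′ D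
  Invariant-≋ {Q} {x} y≋y′ I = record
    { admissible     = Admissible-≋ y≋y′ admissible
    ; leading        = trans (sym (at y≋y′ _)) leading
    ; gap-admissible = Admissible-≋ (-ₚ-cong y≋y′ (≋-refl {qpow Q *ₚ x})) gap-admissible
    }
    where open Invariant I

  -- (𝓡₀ , 𝓡₁) arises by one step of the recurrence from (0 , 1).
  Invariant-R-init : ∀ (c : ℕ → ℕ) → 2 ℕ.≤ c 1 → Invariant (c 1 ∸ 1) (1ℤ ∷ []) (qint (c 1)) (c 1 ∸ 1)
  Invariant-R-init c c₁≥2 = Invariant-≋ y≋qint (Invariant-step (c 1) c₁≥2 (Invariant-init 0))
    where
    y≋qint : qint (c 1) *ₚ (1ℤ ∷ []) -ₚ qpow 0 *ₚ [] ≋ qint (c 1)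
    y≋qint = ≋-trans (-ₚ-cong (≋-trans (*ₚ-comm (qint (c 1)) _) (*ₚ-identityˡ (qint (c 1)))) (*ₚ-zeroʳ (qpow 0)))
                     (+ₚ-identityʳ (qint (c 1)))

  module _ (k : ℕ) (c : ℕ → ℕ) (c≥2 : ∀ i → 1 ℕ.≤ i → i ℕ.≤ k → 2 ℕ.≤ c i) where

    Invariant-iter : ∀ {P D₀} → Invariant (c 1 ∸ 1) (fst P) (snd P) D₀ → ∀ j → suc j ℕ.≤ k →
      ∃[ D ] (D ℕ.+ j ≡ D₀ ℕ.+ sumFrom c 2 j × Invariant (c (suc j) ∸ 1) (fst (iter c P j)) (snd (iter c P j)) D)
    Invariant-iter {D₀ = D₀} I zero    _     = D₀ , refl , I
    Invariant-iter {D₀ = D₀} I (suc j) j+2≤k with Invariant-iter I j (ℕ.<⇒≤ j+2≤k)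
    ... | D , D+j≡ , Iⱼ = D ℕ.+ (C ∸ 1) , degree-eq , Invariant-step C C≥2 Iⱼ
      where
      C = c (suc (suc j))
      C≥2 = c≥2 (suc (suc j)) (s≤s z≤n) j+2≤k
      degree-eq : D ℕ.+ (C ∸ 1) ℕ.+ suc j ≡ D₀ ℕ.+ sumFrom c 2 (suc j)
      degree-eq = begin
        D ℕ.+ (C ∸ 1) ℕ.+ suc j              ≡⟨ +-pred-+-suc D j (ℕ.<⇒≤ C≥2) ⟩
        D ℕ.+ j ℕ.+ C                        ≡⟨ cong (ℕ._+ C) D+j≡ ⟩
        D₀ ℕ.+ sumFrom c 2 j ℕ.+ C           ≡⟨ ℕ.+-assoc D₀ _ C ⟩
        D₀ ℕ.+ (sumFrom c 2 j ℕ.+ C)         ≡⟨ cong (D₀ ℕ.+_) (sym (sumFrom-suc c 2 j)) ⟩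
        D₀ ℕ.+ sumFrom c 2 (suc j)           ∎
        where open ≡-Reasoning

    R-invariant : ∀ j → suc j ℕ.≤ k → Invariant (c (suc j) ∸ 1) (R c j) (R c (suc j)) (sumFrom c 1 (suc j) ∸ suc j)
    R-invariant j j+1≤k =
      let (D , D+j≡ , I) = Invariant-iter (Invariant-R-init c c₁≥2) j j+1≤k
      in  subst (Invariant _ _ _) (R-exponent c (ℕ.<⇒≤ c₁≥2) D+j≡) I
      where
      c₁≥2 : 2 ℕ.≤ c 1
      c₁≥2 = c≥2 1 (s≤s z≤n) (ℕ.≤-trans (s≤s z≤n) j+1≤k)

    S-invariant : ∀ j → suc j ℕ.≤ k → Invariant (c (suc j) ∸ 1) (S c j) (S c (suc j)) (sumFrom c 2 j ℕ.+ 1 ∸ suc j)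
    S-invariant j j+1≤k =
      let (D , D+j≡ , I) = Invariant-iter (Invariant-init (c 1 ∸ 1)) j j+1≤k
      in  subst (Invariant _ _ _) (S-exponent c D+j≡) I

  det : Pair → Pair → Poly
  det (x , y) (u , v) = x *ₚ v -ₚ y *ₚ u

  det-step : ∀ c i P P′ → det (step c i P) (step c i P′) ≋ qpow (c i ∸ 1) *ₚ det P P′
  det-step c i (x , y) (u , v) =
    solve 6 (λ x y u v C Q → y :* (C :* v :- Q :* u) :- (C :* y :- Q :* x) :* v := Q :* (x :* v :- y :* u))
      ≋-refl x y u v (qint (c (suc i))) (qpow (c i ∸ 1))

  det-iter : ∀ c {P P′ e} → det P P′ ≋ qpow e → ∀ j → ∃[ e′ ] det (iter c P j) (iter c P′ j) ≋ qpow e′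
  det-iter c {e = e} det≋qᵉ zero    = e , det≋qᵉ
  det-iter c {P} {P′} det≋qᵉ (suc j) with det-iter c det≋qᵉ j
  ... | e′ , detⱼ≋qᵉ′ = c (suc j) ∸ 1 ℕ.+ e′ , ≋-trans (det-step c (suc j) (iter c P j) (iter c P′ j))
                          (≋-trans (*ₚ-cong (≋-refl {qpow (c (suc j) ∸ 1)}) detⱼ≋qᵉ′) (qpow-*ₚ-qpow _ e′))

  R-S-det≋qpow : ∀ c j → ∃[ e ] R c j *ₚ S c (suc j) -ₚ R c (suc j) *ₚ S c j ≋ qpow e
  R-S-det≋qpow c = det-iter c {(1ℤ ∷ []) , qint (c 1)} {[] , (1ℤ ∷ [])} {0}
    (-ₚ-cong (*ₚ-identityˡ (1ℤ ∷ [])) (*ₚ-zeroʳ (qint (c 1))))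

  R-S-coprime : ∀ c j → coeff (R c j) 0 ≡ 1ℤ → Coprime (R c j) (S c j)
  R-S-coprime c j R₀≡1 =
    let (e , det≋qᵉ) = R-S-det≋qpow c j
    in  coprime-of-det≋qpow (R c j) (R c (suc j)) (S c j) (S c (suc j)) e det≋qᵉ R₀≡1

  module _ {Q x y D} (I : Invariant Q x y D) where
    open Invariant I
    open Admissible admissible

    Invariant⇒LeadingTerm : LeadingTerm y D
    Invariant⇒LeadingTerm = leading , degree

    Invariant⇒ConstantTerm : ConstantTerm y 1ℤ
    Invariant⇒ConstantTerm = constant

    Invariant⇒PositiveCoeffs : PositiveCoeffs y
    Invariant⇒PositiveCoeffs = NonNegCoeffs⇒PositiveCoeffs y nonNeg

open import Defs
open import Data.Nat using (ℕ; _≤_; _+_; _∸_)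
open import Data.Integer using (1ℤ)
open import Data.Product using (_×_)

open import Data.Nat using (suc)
open import Data.Product using (_,_)
open Recurrence

proposition1p8 : (k : ℕ) (c : ℕ → ℕ) → (∀ i → 1 ≤ i → i ≤ k → 2 ≤ c i) →
    ∀ i → 1 ≤ i → i ≤ k →
      (LeadingTerm (R c i) (sumFrom c 1 i ∸ i) × ConstantTerm (R c i) 1ℤ)
      × (LeadingTerm (S c i) (sumFrom c 2 (i ∸ 1) + 1 ∸ i) × ConstantTerm (S c i) 1ℤ)
      × (PositiveCoeffs (R c i) × PositiveCoeffs (S c i))
      × Coprime (R c i) (S c i)
proposition1p8 k c c≥2 (suc j) _ j+1≤k =
    (Invariant⇒LeadingTerm Iᴿ , Invariant⇒ConstantTerm Iᴿ)
  , (Invariant⇒LeadingTerm Iˢ , Invariant⇒ConstantTerm Iˢ)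
  , (Invariant⇒PositiveCoeffs Iᴿ , Invariant⇒PositiveCoeffs Iˢ)
  , R-S-coprime c (suc j) (Invariant⇒ConstantTerm Iᴿ)
  where
  Iᴿ = R-invariant k c c≥2 j j+1≤k
  Iˢ = S-invariant k c c≥2 j j+1≤k
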